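{- Let $a,b$ be integers with $3 \nmid ab$ and such that at least one of $a,b$ is congruent to $2 \bmod 3$. Let $S = \{\alpha = \alpha_0 + \alpha_1\mathbf{i} + \alpha_2\mathbf{j} + \alpha_3\mathbf{k} \in LQ_{a,b} \mid 2 \nmid \alpha_0 \text{ and } 3 \nmid \alpha_1\alpha_2\alpha_3\}$. Then for every $\alpha \in S$ there exists $x \in LQ_{a,b}$ such that $\mathrm{Re}(x^3) \equiv \mathrm{Re}(\alpha) \pmod 3$ and $\mathrm{Im}(x^3) \equiv \mathrm{Im}(\alpha) \pmod 6$.
   Context: For integers $a,b$, $LQ_{a,b}$ denotes the quaternion ring $\{\alpha_0 + \alpha_1 \mathbf{i} + \alpha_2 \mathbf{j} + \alpha_3 \mathbf{k} \mid \alpha_n \in \mathbb{Z}\}$ with multiplication determined by $\mathbf{i}^2 = -a$, $\mathbf{j}^2 = -b$, $\mathbf{i}\mathbf{j} = -\mathbf{j}\mathbf{i} = \mathbf{k}$. For $x = x_0 + x_1\mathbf{i} + x_2\mathbf{j} + x_3\mathbf{k}$, $\mathrm{Re}(x) = x_0 \in \mathbb{Z}$ and $\mathrm{Im}(x) = x_1\mathbf{i} + x_2\mathbf{j} + x_3\mathbf{k}$. We write $\mathrm{Im}(x) \equiv \mathrm{Im}(y) \pmod 6$ if $6$ divides each of the coefficients of $\mathrm{Im}(x-y)$. -}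

module Defs where

open import Data.Integer using (ℤ; +_; _+_; _-_; _*_; -_)
open import Data.Integer.Divisibility using (_∣_)

-- Elements α₀ + α₁ i + α₂ j + α₃ k of LQ_{a,b}
record LQ : Set where
  constructor quat
  field
    re : ℤ
    c₁ : ℤ
    c₂ : ℤ
    c₃ : ℤ
open LQ public

-- Multiplication in LQ_{a,b}:  i² = -a, j² = -b, ij = -ji = k
-- (hence k² = -ab, jk = b i, kj = -b i, ki = a j, ik = -a j)
mulQ : ℤ → ℤ → LQ → LQ → LQ
mulQ a b (quat x₀ x₁ x₂ x₃) (quat y₀ y₁ y₂ y₃) = quat
  (x₀ * y₀ - a * (x₁ * y₁) - b * (x₂ * y₂) - (a * b) * (x₃ * y₃))
  (x₀ * y₁ + x₁ * y₀ + b * (x₂ * y₃) - b * (x₃ * y₂))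
  (x₀ * y₂ + x₂ * y₀ - a * (x₁ * y₃) + a * (x₃ * y₁))
  (x₀ * y₃ + x₃ * y₀ + x₁ * y₂ - x₂ * y₁)

cubeQ : ℤ → ℤ → LQ → LQ
cubeQ a b x = mulQ a b (mulQ a b x x) x

_≡_[mod_] : ℤ → ℤ → ℤ → Set
m ≡ n [mod d ] = d ∣ (m - n)

ImCong : ℤ → LQ → LQ → Set
ImCong d x y = (c₁ x ≡ c₁ y [mod d ]) × ((c₂ x ≡ c₂ y [mod d ]) × (c₃ x ≡ c₃ y [mod d ]))
  where open import Data.Product using (_×_)

InS : LQ → Set
InS α = (¬ (+ 2 ∣ re α)) × (¬ (+ 3 ∣ (c₁ α * c₂ α * c₃ α)))
  where open import Data.Product using (_×_)
        open import Relation.Nullary using (¬_)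

module Submission where

-- Write a quaternion as x = x₀ + v with v = p i + q j + r k
-- pure, and let N(v) = a p² + b q² + ab r², so that v² = -N(v).  Since x₀
-- commutes with v, expanding gives
--     x³ = (x₀³ - 3 x₀ N(v)) + (3 x₀² - N(v)) v .
-- Given α = α₀ + v in S we keep the imaginary part v and only choose x₀.
-- Because 3 ∤ p q r, each of p², q², r² is 1 mod 3, so N(v) + 1 ≡ a + b + ab + 1
-- = (a + 1)(b + 1) ≡ 0 (mod 3), as a or b is 2 mod 3.  Put m = N(v) + 1 and
-- x₀ = 4 α₀ + 3 m.  Then x₀ ≡ α₀ (mod 3), and by Fermat x₀³ ≡ x₀, giving the
-- real part; and 3 x₀² - N(v) - 1 = 3 x₀² - m is divisible by 3 (as 3 ∣ m) and
-- by 2 (as 3 x₀² - m ≡ m² - m), hence by 6, giving the imaginary part.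

open import Defs
open import Data.Integer using (ℤ; +_; _*_)
open import Data.Integer.Divisibility using (_∣_)
open import Data.Product using (_×_; ∃-syntax)
open import Data.Sum using (_⊎_)
open import Relation.Nullary using (¬_)

open import Data.Integer.Base using (_+_; _-_; -_; _%_; _/_)
open import Data.Integer.DivMod using (a≡a%n+[a/n]*n; n%d<d)
import Data.Integer.Divisibility.Signed as Signed
open Signed using (divides; ∣m∣n⇒∣m+n; ∣m∣n⇒∣m-n; ∣m⇒∣m*n; ∣n⇒∣m*n; ∣ᵤ⇒∣; ∣⇒∣ᵤ)
open import Data.Integer.Tactic.RingSolver using (solve-∀)
open import Data.Nat.Base using (suc; s≤s)
open import Data.Product using (_,_)
open import Data.Sum using (inj₁; inj₂; [_,_]′)
open import Data.Empty using (⊥-elim)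
open import Relation.Binary.PropositionalEquality using (_≡_; refl; sym; subst; cong₂; module ≡-Reasoning)

∣-resp : ∀ {d x y} → x ≡ y → d Signed.∣ y → d Signed.∣ x
∣-resp x≡y d∣y = subst (_ Signed.∣_) (sym x≡y) d∣y

-- The quadratic form N(v) = -v² on the pure part v = p i + q j + r k of LQ_{a,b}.
normIm : ℤ → ℤ → ℤ → ℤ → ℤ → ℤ
normIm a b p q r = a * (p * p) + b * (q * q) + (a * b) * (r * r)

module _ (a b x₀ p q r : ℤ) where

  private
    x : LQ
    x = quat x₀ p q r

    s : ℤ
    s = + 3 * x₀ * x₀ - normIm a b p q r

  cube-re : re (cubeQ a b x) ≡ x₀ * x₀ * x₀ - + 3 * x₀ * normIm a b p q r
  cube-re = identity a b x₀ p q r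
    where
    identity : ∀ a b x₀ p q r →
      (x₀ * x₀ - a * (p * p) - b * (q * q) - (a * b) * (r * r)) * x₀
        - a * ((x₀ * p + p * x₀ + b * (q * r) - b * (r * q)) * p)
        - b * ((x₀ * q + q * x₀ - a * (p * r) + a * (r * p)) * q)
        - (a * b) * ((x₀ * r + r * x₀ + p * q - q * p) * r)
      ≡ x₀ * x₀ * x₀ - + 3 * x₀ * (a * (p * p) + b * (q * q) + (a * b) * (r * r))
    identity = solve-∀

  cube-c₁ : c₁ (cubeQ a b x) ≡ s * p
  cube-c₁ = identity a b x₀ p q r
    where
    identity : ∀ a b x₀ p q r →
      (x₀ * x₀ - a * (p * p) - b * (q * q) - (a * b) * (r * r)) * p
        + (x₀ * p + p * x₀ + b * (q * r) - b * (r * q)) * x₀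
        + b * ((x₀ * q + q * x₀ - a * (p * r) + a * (r * p)) * r)
        - b * ((x₀ * r + r * x₀ + p * q - q * p) * q)
      ≡ (+ 3 * x₀ * x₀ - (a * (p * p) + b * (q * q) + (a * b) * (r * r))) * p
    identity = solve-∀

  cube-c₂ : c₂ (cubeQ a b x) ≡ s * q
  cube-c₂ = identity a b x₀ p q r
    where
    identity : ∀ a b x₀ p q r →
      (x₀ * x₀ - a * (p * p) - b * (q * q) - (a * b) * (r * r)) * q
        + (x₀ * q + q * x₀ - a * (p * r) + a * (r * p)) * x₀
        - a * ((x₀ * p + p * x₀ + b * (q * r) - b * (r * q)) * r)
        + a * ((x₀ * r + r * x₀ + p * q - q * p) * p)
      ≡ (+ 3 * x₀ * x₀ - (a * (p * p) + b * (q * q) + (a * b) * (r * r))) * q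
    identity = solve-∀

  cube-c₃ : c₃ (cubeQ a b x) ≡ s * r
  cube-c₃ = identity a b x₀ p q r
    where
    identity : ∀ a b x₀ p q r →
      (x₀ * x₀ - a * (p * p) - b * (q * q) - (a * b) * (r * r)) * r
        + (x₀ * r + r * x₀ + p * q - q * p) * x₀
        + (x₀ * p + p * x₀ + b * (q * r) - b * (r * q)) * q
        - (x₀ * q + q * x₀ - a * (p * r) + a * (r * p)) * p
      ≡ (+ 3 * x₀ * x₀ - (a * (p * p) + b * (q * q) + (a * b) * (r * r))) * r
    identity = solve-∀

scale-fixes : ∀ {d} s y → d Signed.∣ s - + 1 → d Signed.∣ s * y - y
scale-fixes s y d∣s-1 = ∣-resp (identity s y) (∣m⇒∣m*n y d∣s-1)
  where
  identity : ∀ s y → s * y - y ≡ (s - + 1) * y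
  identity = solve-∀

mod3-cases : ∀ y → (∃[ q ] y ≡ + 0 + q * + 3) ⊎ (∃[ q ] y ≡ + 1 + q * + 3) ⊎ (∃[ q ] y ≡ + 2 + q * + 3)
mod3-cases y with y % + 3 | n%d<d y (+ 3) | a≡a%n+[a/n]*n y (+ 3)
... | 0 | _ | y≡ = inj₁ (y / + 3 , y≡)
... | 1 | _ | y≡ = inj₂ (inj₁ (y / + 3 , y≡))
... | 2 | _ | y≡ = inj₂ (inj₂ (y / + 3 , y≡))
... | suc (suc (suc _)) | s≤s (s≤s (s≤s ())) | _

mod2-cases : ∀ y → (∃[ q ] y ≡ + 0 + q * + 2) ⊎ (∃[ q ] y ≡ + 1 + q * + 2)
mod2-cases y with y % + 2 | n%d<d y (+ 2) | a≡a%n+[a/n]*n y (+ 2)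
... | 0 | _ | y≡ = inj₁ (y / + 2 , y≡)
... | 1 | _ | y≡ = inj₂ (y / + 2 , y≡)
... | suc (suc _) | s≤s (s≤s ()) | _

cube-mod3 : ∀ y → + 3 Signed.∣ y * y * y - y
cube-mod3 y with mod3-cases y
... | inj₁ (q , refl) = divides (+ 9 * q * q * q - q) (identity q)
  where
  identity : ∀ q → (+ 0 + q * + 3) * (+ 0 + q * + 3) * (+ 0 + q * + 3) - (+ 0 + q * + 3)
                   ≡ (+ 9 * q * q * q - q) * + 3
  identity = solve-∀
... | inj₂ (inj₁ (q , refl)) = divides (+ 9 * q * q * q + + 9 * q * q + + 2 * q) (identity q)
  where
  identity : ∀ q → (+ 1 + q * + 3) * (+ 1 + q * + 3) * (+ 1 + q * + 3) - (+ 1 + q * + 3)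
                   ≡ (+ 9 * q * q * q + + 9 * q * q + + 2 * q) * + 3
  identity = solve-∀
... | inj₂ (inj₂ (q , refl)) = divides (+ 9 * q * q * q + + 18 * q * q + + 11 * q + + 2) (identity q)
  where
  identity : ∀ q → (+ 2 + q * + 3) * (+ 2 + q * + 3) * (+ 2 + q * + 3) - (+ 2 + q * + 3)
                   ≡ (+ 9 * q * q * q + + 18 * q * q + + 11 * q + + 2) * + 3
  identity = solve-∀

square-mod3 : ∀ y → ¬ (+ 3 Signed.∣ y) → + 3 Signed.∣ y * y - + 1
square-mod3 y 3∤y with mod3-cases y
... | inj₁ (q , refl) = ⊥-elim (3∤y (divides q (identity q)))
  where
  identity : ∀ q → + 0 + q * + 3 ≡ q * + 3
  identity = solve-∀
... | inj₂ (inj₁ (q , refl)) = divides (+ 3 * q * q + + 2 * q) (identity q)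
  where
  identity : ∀ q → (+ 1 + q * + 3) * (+ 1 + q * + 3) - + 1 ≡ (+ 3 * q * q + + 2 * q) * + 3
  identity = solve-∀
... | inj₂ (inj₂ (q , refl)) = divides (+ 3 * q * q + + 4 * q + + 1) (identity q)
  where
  identity : ∀ q → (+ 2 + q * + 3) * (+ 2 + q * + 3) - + 1 ≡ (+ 3 * q * q + + 4 * q + + 1) * + 3
  identity = solve-∀

square-mod2 : ∀ y → + 2 Signed.∣ y * y - y
square-mod2 y with mod2-cases y
... | inj₁ (q , refl) = divides (+ 2 * q * q - q) (identity q)
  where
  identity : ∀ q → (+ 0 + q * + 2) * (+ 0 + q * + 2) - (+ 0 + q * + 2) ≡ (+ 2 * q * q - q) * + 2
  identity = solve-∀
... | inj₂ (q , refl) = divides (+ 2 * q * q + q) (identity q)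
  where
  identity : ∀ q → (+ 1 + q * + 2) * (+ 1 + q * + 2) - (+ 1 + q * + 2) ≡ (+ 2 * q * q + q) * + 2
  identity = solve-∀

divisible-by-6 : ∀ w → + 2 Signed.∣ w → + 3 Signed.∣ w → + 6 Signed.∣ w
divisible-by-6 w (divides s w≡2s) (divides t w≡3t) = divides (s - t) (begin
    w                                 ≡⟨ split w ⟩
    + 3 * w - + 2 * w                 ≡⟨ cong₂ (λ u v → + 3 * u - + 2 * v) w≡2s w≡3t ⟩
    + 3 * (s * + 2) - + 2 * (t * + 3) ≡⟨ collect s t ⟩
    (s - t) * + 6                     ∎)
  where
  open ≡-Reasoning
  split : ∀ w → w ≡ + 3 * w - + 2 * w
  split = solve-∀
  collect : ∀ s t → + 3 * (s * + 2) - + 2 * (t * + 3) ≡ (s - t) * + 6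
  collect = solve-∀

module _ (p q r : ℤ) (3∤pqr : ¬ (+ 3 Signed.∣ p * q * r)) where

  3∤first : ¬ (+ 3 Signed.∣ p)
  3∤first 3∣p = 3∤pqr (∣m⇒∣m*n r (∣m⇒∣m*n q 3∣p))

  3∤second : ¬ (+ 3 Signed.∣ q)
  3∤second 3∣q = 3∤pqr (∣m⇒∣m*n r (∣n⇒∣m*n p 3∣q))

  3∤third : ¬ (+ 3 Signed.∣ r)
  3∤third 3∣r = 3∤pqr (∣n⇒∣m*n (p * q) 3∣r)

succ-product-mod3 : ∀ a b → a ≡ + 2 [mod + 3 ] ⊎ b ≡ + 2 [mod + 3 ] →
                    + 3 Signed.∣ (a + + 1) * (b + + 1)
succ-product-mod3 a b = [ (λ a≡2 → ∣m⇒∣m*n (b + + 1) (succ-mod3 a (∣ᵤ⇒∣ a≡2)))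
                        , (λ b≡2 → ∣n⇒∣m*n (a + + 1) (succ-mod3 b (∣ᵤ⇒∣ b≡2))) ]′
  where
  succ-mod3 : ∀ c → + 3 Signed.∣ c - + 2 → + 3 Signed.∣ c + + 1
  succ-mod3 c 3∣c-2 = ∣-resp (identity c) (∣m∣n⇒∣m+n 3∣c-2 (divides (+ 1) refl))
    where
    identity : ∀ c → c + + 1 ≡ (c - + 2) + + 1 * + 3
    identity = solve-∀

normIm-mod3 : ∀ a b p q r → a ≡ + 2 [mod + 3 ] ⊎ b ≡ + 2 [mod + 3 ] →
              ¬ (+ 3 Signed.∣ p * q * r) → + 3 Signed.∣ normIm a b p q r + + 1
normIm-mod3 a b p q r a-or-b≡2 3∤pqr = ∣-resp (regroup a b p q r)
  (∣m∣n⇒∣m+n (∣m∣n⇒∣m+n (∣m∣n⇒∣m+n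
    (∣n⇒∣m*n a (square-mod3 p (3∤first p q r 3∤pqr)))
    (∣n⇒∣m*n b (square-mod3 q (3∤second p q r 3∤pqr))))
    (∣n⇒∣m*n (a * b) (square-mod3 r (3∤third p q r 3∤pqr))))
    (succ-product-mod3 a b a-or-b≡2))
  where
  regroup : ∀ a b p q r → a * (p * p) + b * (q * q) + (a * b) * (r * r) + + 1 ≡
    a * (p * p - + 1) + b * (q * q - + 1) + (a * b) * (r * r - + 1) + (a + + 1) * (b + + 1)
  regroup = solve-∀

-- The real part to be chosen: x₀ = 4 α₀ + 3 m, where m plays the role of N(v) + 1.
realPart : ℤ → ℤ → ℤ
realPart α₀ m = + 4 * α₀ + + 3 * m

realPart-mod3 : ∀ α₀ m → + 3 Signed.∣ realPart α₀ m - α₀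
realPart-mod3 α₀ m = divides (α₀ + m) (identity α₀ m)
  where
  identity : ∀ α₀ m → (+ 4 * α₀ + + 3 * m) - α₀ ≡ (α₀ + m) * + 3
  identity = solve-∀

real-cube-mod3 : ∀ x₀ α₀ n → + 3 Signed.∣ x₀ - α₀ → + 3 Signed.∣ (x₀ * x₀ * x₀ - + 3 * x₀ * n) - α₀
real-cube-mod3 x₀ α₀ n 3∣x₀-α₀ = ∣-resp (regroup x₀ n α₀)
  (∣m∣n⇒∣m+n (∣m∣n⇒∣m+n (cube-mod3 x₀) 3∣x₀-α₀) (divides (- (x₀ * n)) refl))
  where
  regroup : ∀ x₀ n α₀ → x₀ * x₀ * x₀ - + 3 * x₀ * n - α₀ ≡ (x₀ * x₀ * x₀ - x₀) + (x₀ - α₀) + (- (x₀ * n)) * + 3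
  regroup = solve-∀

scalar-realPart-mod6 : ∀ α₀ m → + 3 Signed.∣ m → + 6 Signed.∣ + 3 * realPart α₀ m * realPart α₀ m - m
scalar-realPart-mod6 α₀ m 3∣m = divisible-by-6 _ even multipleOf3
  where
  x₀ : ℤ
  x₀ = realPart α₀ m
  multipleOf3 : + 3 Signed.∣ + 3 * x₀ * x₀ - m
  multipleOf3 = ∣-resp (commute x₀ m) (∣m∣n⇒∣m-n (divides (x₀ * x₀) refl) 3∣m)
    where
    commute : ∀ x₀ m → + 3 * x₀ * x₀ - m ≡ (x₀ * x₀) * + 3 - m
    commute = solve-∀
  even : + 2 Signed.∣ + 3 * x₀ * x₀ - m
  even = ∣-resp (regroup α₀ m)
    (∣m∣n⇒∣m+n (square-mod2 m) (divides (+ 24 * α₀ * α₀ + + 36 * α₀ * m + + 13 * m * m) refl))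
    where
    regroup : ∀ α₀ m → + 3 * (+ 4 * α₀ + + 3 * m) * (+ 4 * α₀ + + 3 * m) - m ≡
              (m * m - m) + (+ 24 * α₀ * α₀ + + 36 * α₀ * m + + 13 * m * m) * + 2
    regroup = solve-∀

mainTheorem4 : (a b : ℤ) → ¬ (+ 3 ∣ a * b) → (a ≡ + 2 [mod + 3 ] ⊎ b ≡ + 2 [mod + 3 ]) →
    (α : LQ) → InS α →
    ∃[ x ] ((re (cubeQ a b x) ≡ re α [mod + 3 ]) × ImCong (+ 6) (cubeQ a b x) α)
mainTheorem4 a b _ a-or-b≡2 (quat α₀ p q r) (_ , 3∤pqr) =
  x , ∣⇒∣ᵤ realGoal , ∣⇒∣ᵤ (imGoal p (cube-c₁ a b x₀ p q r))
                    , ∣⇒∣ᵤ (imGoal q (cube-c₂ a b x₀ p q r))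
                    , ∣⇒∣ᵤ (imGoal r (cube-c₃ a b x₀ p q r))
  where
  n m x₀ : ℤ
  n = normIm a b p q r
  m = n + + 1
  x₀ = realPart α₀ m
  x : LQ
  x = quat x₀ p q r
  realGoal : + 3 Signed.∣ re (cubeQ a b x) - α₀
  realGoal = subst (λ z → + 3 Signed.∣ z - α₀) (sym (cube-re a b x₀ p q r))
    (real-cube-mod3 x₀ α₀ n (realPart-mod3 α₀ m))
  -- the scalar 3 x₀² - N(v) multiplying v in x³ is 1 mod 6
  scalar≡1 : + 6 Signed.∣ (+ 3 * x₀ * x₀ - n) - + 1
  scalar≡1 = ∣-resp (shift (+ 3 * x₀ * x₀) n)
    (scalar-realPart-mod6 α₀ m (normIm-mod3 a b p q r a-or-b≡2 (λ 3∣pqr → 3∤pqr (∣⇒∣ᵤ 3∣pqr))))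
    where
    shift : ∀ t n → (t - n) - + 1 ≡ t - (n + + 1)
    shift = solve-∀
  imGoal : ∀ y {c} → c ≡ (+ 3 * x₀ * x₀ - n) * y → + 6 Signed.∣ c - y
  imGoal y c≡ = subst (λ z → + 6 Signed.∣ z - y) (sym c≡) (scale-fixes (+ 3 * x₀ * x₀ - n) y scalar≡1)
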